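{- Let $(\mathcal{G},\mathcal{I})$ be a $k$-exchange system, $f:2^{\mathcal{G}}\to\mathbb{R}_{+}$ a monotone submodular function, and $\epsilon\in(0,1)$. Let $S$ be the solution returned by the Non-Oblivious Local Search algorithm described in the context, let $\prec$ and $w$ be the ordering and weights on $S$ of its final iteration, and let $O\in\mathcal{I}$ be an independent set maximizing $f$. Let $\{Y_e\}_{e\in O}$ be a neighborhood collection for $(O,S)$, and for $x\in S$ let $P_x=\{e\in O : x\in Y_e \text{ and } w(z)\le w(x)\text{ for all } z\in Y_e\}$ and $N_x=\bigcup_{e\in P_x}Y_e$. Then for each $x\in S$, $$w(x)\;\ge\;\sum_{e\in P_x}\Big(2\,w_{(P_x,N_x)}(e)-\sum_{z\in Y_e}w(z)\Big).$$
   Context: An independence system $(\mathcal{G},\mathcal{I})$: finite ground set $\mathcal{G}$, $n=|\mathcal{G}|$, nonempty downward-closed $\mathcal{I}\subseteq 2^{\mathcal{G}}$. It is a $k$-exchange system ($k\ge1$ an integer) if for all $A,B\in\mathcal{I}$ there is a collection $\{Y_e\subseteq B\setminus A: e\in A\setminus B\}$ with (K1) $|Y_e|\le k$; (K2) each $x\in B\setminus A$ lies in at most $k$ sets $Y_e$; (K3) for every $C\subseteq A\setminus B$, $(B\setminus\bigcup_{e\in C}Y_e)\cup C\in\mathcal{I}$. A neighborhood collection for $(O,S)$ is such a collection for $A=O,B=S$, extended by $Y_e=\{e\}$ for $e\in O\cap S$. Given a current solution $S\in\mathcal{I}$, a $k$-replacement is a pair $(A,B)$ with $B\subseteq S$,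 $A\subseteq\mathcal{G}\setminus(S\setminus B)$, $|A|\le k$, $|B|\le k^2-k+1$, and $(S\setminus B)\cup A\in\mathcal{I}$. Algorithm (Non-Oblivious Local Search): let $S_{init}=\{e^*\}$ where $e^*$ maximizes $f(\{e\})$; $\delta=(1+\frac{k+3}{2\epsilon})^{ -1}$, $\alpha=f(S_{init})\delta/n$; start with $S=S_{init}$ and an arbitrary total order $\prec$ on $\mathcal{G}$. In each iteration: list $S=\{s_1,\dots,s_m\}$ in $\prec$-order, $S_i=\{s_1,\dots,s_i\}$, and set $w(s_i)=\lfloor (f(S_{i-1}\cup\{s_i\})-f(S_{i-1}))/\alpha\rfloor\alpha$. For each $k$-replacement $(A,B)$, list $A=\{a_1,\dots,a_r\}$ in $\prec$-order, $A_i=\{a_1,\dots,a_i\}$, and set $w_{(A,B)}(a_i)=\lfloor (f((S\setminus B)\cup A_{i-1}\cup\{a_i\})-f((S\setminus B)\cup A_{i-1}))/\alpha\rfloor\alpha$. If $\sum_{a\in A}w_{(A,B)}(a)^2>\sum_{b\in B}w(b)^2$, replace $\prec$ by the order $\prec'$ in which every element of $S\setminus B$ precedes every element of $A$ and all other pairs are ordered as in $\prec$, replace $S$ by $(S\setminus B)\cup A$, and start the next iteration. If no $k$-replacement satisfies the condition, return $S$. The same formula defines $w_{(A,B)}$ for any $B\subseteq S$, $A\subseteq\mathcal{G}\setminus(S\setminus B)$.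
   Formalization: The function f takes nonnegative rational values rather than values in ℝ₊, and the parameter ε is a rational number in (0,1). -}

module Defs where

open import Data.Nat as ℕ using (ℕ; zero; suc; _∸_)
open import Data.Fin as Fin using (Fin)
open import Data.Fin.Subset using (Subset; _∈_; _∉_; _⊆_; _∪_; _∩_; _─_; ⁅_⁆; ∣_∣) renaming (⊥ to ∅)
open import Data.Fin.Subset.Properties using (_∈?_)
open import Data.Rational using (ℚ; 0ℚ; 1ℚ; _+_; _*_; _-_; _≤_; _<_; _÷_; floor; ≢-nonZero; _/_)
open import Data.Rational.Properties using (_≟_)
open import Data.Integer using (ℤ; +_)
open import Data.List using (List; []; _∷_; filter; foldr; allFin; _++_)
open import Data.List.Relation.Binary.Permutation.Propositional using (_↭_)
open import Data.Product using (_×_; _,_; Σ; ∃; ∃-syntax)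
open import Relation.Nullary using (¬_; yes; no)
open import Relation.Binary.PropositionalEquality using (_≡_)
open import Relation.Binary.Construct.Closure.ReflexiveTransitive using (Star)

private
  variable
    n : ℕ

_⇔_ : Set → Set → Set
P ⇔ Q = (P → Q) × (Q → P)

IndependenceSystem : (Subset n → Set) → Set
IndependenceSystem {n} I = (∃[ A ] I A) × (∀ (A B : Subset n) → A ⊆ B → I B → I A)

-- (K1),(K2),(K3) for the pair (A,B) and the collection Y (only Y e for e ∈ A ─ B matter)
ExchangeCollection : ℕ → (Subset n → Set) → Subset n → Subset n → (Fin n → Subset n) → Set
ExchangeCollection {n} k I A B Y =
    (∀ e → e ∈ A ─ B → (Y e ⊆ B ─ A) × (∣ Y e ∣ ℕ.≤ k))
  × (∀ x → x ∈ B ─ A → (E : Subset n) → (∀ e → (e ∈ E) ⇔ (e ∈ A ─ B × x ∈ Y e)) → ∣ E ∣ ℕ.≤ k)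
  × (∀ (C U : Subset n) → C ⊆ A ─ B → (∀ y → (y ∈ U) ⇔ (∃[ e ] (e ∈ C × y ∈ Y e))) → I ((B ─ U) ∪ C))

KExchangeSystem : ℕ → (Subset n → Set) → Set
KExchangeSystem {n} k I =
  IndependenceSystem I × (∀ (A B : Subset n) → I A → I B → ∃[ Y ] ExchangeCollection k I A B Y)

NeighborhoodCollection : ℕ → (Subset n → Set) → Subset n → Subset n → (Fin n → Subset n) → Set
NeighborhoodCollection k I O S Y = ExchangeCollection k I O S Y × (∀ e → e ∈ O → e ∈ S → Y e ≡ ⁅ e ⁆)

NonNegative : (Subset n → ℚ) → Set
NonNegative f = ∀ A → 0ℚ ≤ f A

Monotone : (Subset n → ℚ) → Set
Monotone f = ∀ A B → A ⊆ B → f A ≤ f B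

Submodular : (Subset n → ℚ) → Set
Submodular f = ∀ A B → f (A ∪ B) + f (A ∩ B) ≤ f A + f B

-- ⌊ x / α ⌋ · α   (taken to be 0 when α = 0, which agrees with any convention since it is multiplied by α)
quant : ℚ → ℚ → ℚ
quant α x with α ≟ 0ℚ
... | yes _ = 0ℚ
... | no α≢0 = ((floor (_÷_ x α {{≢-nonZero α≢0}})) / 1) * α

inOrder : List (Fin n) → Subset n → List (Fin n)
inOrder ord X = filter (λ x → x ∈? X) ord

-- wt f α base [a₁,…,a_r] y : the weight of y = a_i is
--   quant α (f(base ∪ {a₁..a_{i-1}} ∪ {a_i}) - f(base ∪ {a₁..a_{i-1}}))   (0 if y is not listed)
wt : (Subset n → ℚ) → ℚ → Subset n → List (Fin n) → Fin n → ℚ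
wt f α base [] y = 0ℚ
wt f α base (x ∷ xs) y with x Fin.≟ y
... | yes _ = quant α (f (base ∪ ⁅ x ⁆) - f base)
... | no _ = wt f α (base ∪ ⁅ x ⁆) xs y

weight : (Subset n → ℚ) → ℚ → List (Fin n) → Subset n → Fin n → ℚ
weight f α ord S = wt f α ∅ (inOrder ord S)

replWeight : (Subset n → ℚ) → ℚ → List (Fin n) → Subset n → Subset n → Subset n → Fin n → ℚ
replWeight f α ord S A B = wt f α (S ─ B) (inOrder ord A)

sumOver : Subset n → (Fin n → ℚ) → ℚ
sumOver {n} X g = foldr (λ x acc → g x + acc) 0ℚ (inOrder (allFin n) X)

IsKReplacement : ℕ → (Subset n → Set) → Subset n → Subset n → Subset n → Set
IsKReplacement k I S A B =
    B ⊆ S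
  × (∀ a → a ∈ A → a ∉ S ─ B)
  × ∣ A ∣ ℕ.≤ k
  × ∣ B ∣ ℕ.≤ k ℕ.* k ∸ k ℕ.+ 1
  × I ((S ─ B) ∪ A)

Improving : (Subset n → ℚ) → ℚ → List (Fin n) → Subset n → Subset n → Subset n → Set
Improving f α ord S A B =
  sumOver B (λ b → weight f α ord S b * weight f α ord S b)
    < sumOver A (λ a → replWeight f α ord S A B a * replWeight f α ord S A B a)

-- algorithm state: current solution and current total order on the ground set (as a list)
State : ℕ → Set
State n = Subset n × List (Fin n)

Step : ℕ → (Subset n → Set) → (Subset n → ℚ) → ℚ → State n → State n → Set
Step {n} k I f α (S , ord) (S' , ord') = ∃[ A ] ∃[ B ]
    IsKReplacement k I S A B
  × Improving f α ord S A B
  × S' ≡ (S ─ B) ∪ A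
  × allFin n ↭ ord'
  × inOrder ord' ((S ─ B) ∪ A) ≡ inOrder ord (S ─ B) ++ inOrder ord A

Returned : ℕ → (Subset n → Set) → (Subset n → ℚ) → ℚ → State n → State n → Set
Returned k I f α (S₀ , ord₀) (S , ord) =
    Star (Step k I f α) (S₀ , ord₀) (S , ord)
  × (∀ A B → IsKReplacement k I S A B → ¬ Improving f α ord S A B)

{-# OPTIONS --safe #-}
-- Write W = w(x), a(e) = w_{(P,N)}(e) and c(e) = Σ_{z ∈ Y_e} w(z).  The pair (P, N) is a
-- k-replacement, so local optimality of S gives Σ_P a² ≤ Σ_N w², and Σ_N w² ≤ W·Σ_N w because
-- every z ∈ N lies in some Y_e with e ∈ P, whence w(z) ≤ W.  Since x ∈ Y_e for every e ∈ P,
-- counting N against these sets gives Σ_N w ≤ W + Σ_P (c − W).  Adding up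
-- W(2a − c) ≤ a² − W(c − W), i.e. (a − W)² ≥ 0, over P therefore yields
-- W·Σ_P (2a − c) ≤ W², and we divide by W when it is positive.  When W = 0 the same chain
-- gives Σ_P a² ≤ 0, so every a(e) ≤ 0 and every summand 2a − c is nonpositive.
module Submission where

open import Defs
open import Data.Nat as ℕ using (ℕ)
open import Data.Fin using (Fin)
open import Data.Fin.Subset using (Subset; _∈_; ⁅_⁆)
open import Data.Rational using (ℚ; 0ℚ; 1ℚ; _+_; _*_; _-_; _≤_; _<_; _/_)
open import Data.Integer using (+_)
open import Data.List using (List; allFin)
open import Data.List.Relation.Binary.Permutation.Propositional using (_↭_)
open import Relation.Binary.PropositionalEquality using (_≡_)
open import Data.Product using (_×_; _,_; ∃-syntax)

open import Algebra.Bundles using (module Ring)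
open import Data.Bool.Base using (true; false; if_then_else_)
open import Data.Fin as Fin using (zero; suc)
open import Data.Fin.Subset using (_∉_; _⊆_; ⊥; _∪_; _─_; ∣_∣; inside; outside)
open import Data.Fin.Subset.Properties
  using (_∈?_; ∉⊥; x∈⁅x⁆; x∈⁅y⁆⇒x≡y; x≢y⇒x∉⁅y⁆; p⊆p∪q; x∈p∪q⁺; x∈p∪q⁻; p─q⊆p; x∈p∧x∉q⇒x∈p─q;
         x∈p∧x≢y⇒x∈p-y; ∣⊥∣≡0; ∣⁅x⁆∣≡1; p⊆q⇒∣p∣≤∣q∣; x∈p⇒∣p-x∣<∣p∣)
open import Data.Integer as ℤ using (0ℤ) renaming (_≤_ to _≤ᶻ_)
import Data.Integer.Properties as ℤ
open import Data.Integer.DivMod using (0≤n⇒0≤n/d)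
open import Data.List using ([]; _∷_; tabulate; foldr)
open import Data.Nat using (zero; suc)
import Data.Nat.Properties as ℕ
open import Data.Product using (proj₁; proj₂)
open import Data.Rational
  using (-_; NonZero; Positive; nonNegative; nonPositive; positive; floor; ↥_; ↧_; _÷_; ≢-nonZero)
open import Data.Rational.Properties
open import Data.Rational.Solver using (module +-*-Solver)
open import Data.Sum using (inj₁; inj₂)
import Data.Vec.Base as Vec
open import Data.Vec.Base using ([]; _∷_; here; there)
open import Data.Vec.Functional using (removeAt)
open import Data.Vec.Properties using (lookup∘tabulate; lookup⇒[]=; []=⇒lookup)
open import Function using (_∘_)
open import Relation.Binary.PropositionalEquality using (refl; sym; trans; cong; cong₂; subst; subst₂; module ≡-Reasoning)
open import Relation.Nullary using (Dec; does; yes; no; contradiction; _×-dec_)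
open import Algebra.Properties.Semiring.Sum (Ring.semiring +-*-ring)
  using (sum; sum-cong-≗; sum-replicate-zero; sum-remove; ∑-distrib-+; ∑-comm; *-distribˡ-sum)

private
  variable
    n : ℕ

∑-mono-≤ : {f g : Fin n → ℚ} → (∀ i → f i ≤ g i) → sum f ≤ sum g
∑-mono-≤ {zero} f≤g = ≤-refl
∑-mono-≤ {suc n} f≤g = +-mono-≤ (f≤g zero) (∑-mono-≤ (f≤g ∘ suc))

∑-nonneg : {f : Fin n → ℚ} → (∀ i → 0ℚ ≤ f i) → 0ℚ ≤ sum f
∑-nonneg {n} 0≤f = ≤-trans (≤-reflexive (sym (sum-replicate-zero n))) (∑-mono-≤ 0≤f)

∑-nonpos : {f : Fin n → ℚ} → (∀ i → f i ≤ 0ℚ) → sum f ≤ 0ℚ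
∑-nonpos {n} f≤0 = ≤-trans (∑-mono-≤ f≤0) (≤-reflexive (sum-replicate-zero n))

∑-neg : (f : Fin n → ℚ) → sum (λ i → - f i) ≡ - sum f
∑-neg {zero} f = refl
∑-neg {suc n} f = trans (cong (_+_ (- f zero)) (∑-neg (f ∘ suc))) (sym (neg-distrib-+ (f zero) _))

∑-distrib-− : (f g : Fin n → ℚ) → sum (λ i → f i - g i) ≡ sum f - sum g
∑-distrib-− f g = trans (∑-distrib-+ f (λ i → - g i)) (cong (_+_ (sum f)) (∑-neg g))

term≤∑ : {f : Fin n → ℚ} → (∀ i → 0ℚ ≤ f i) → ∀ i → f i ≤ sum f
term≤∑ {suc n} {f} 0≤f i = begin
  f i                       ≡⟨ +-identityʳ (f i) ⟨
  f i + 0ℚ                  ≤⟨ +-monoʳ-≤ (f i) (∑-nonneg (λ j → 0≤f (Fin.punchIn i j))) ⟩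
  f i + sum (removeAt f i)  ≡⟨ sum-remove f ⟨
  sum f                     ∎
  where open ≤-Reasoning

-- sumOver folds over a filtered list; rewriting it as the full sum of the restriction
-- (sumOver-restrict) makes the library's algebra of ∑ available.
restrict : Subset n → (Fin n → ℚ) → Fin n → ℚ
restrict X g i = if does (i ∈? X) then g i else 0ℚ

restrict-∈ : (X : Subset n) (g : Fin n → ℚ) {i : Fin n} → i ∈ X → restrict X g i ≡ g i
restrict-∈ X g {i} i∈X with i ∈? X
... | yes _ = refl
... | no i∉X = contradiction i∈X i∉X

restrict-∉ : (X : Subset n) (g : Fin n → ℚ) {i : Fin n} → i ∉ X → restrict X g i ≡ 0ℚ
restrict-∉ X g {i} i∉X with i ∈? X
... | yes i∈X = contradiction i∈X i∉X
... | no _ = refl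

restrict-cong : (X : Subset n) {g h : Fin n → ℚ} → (∀ i → g i ≡ h i) → ∀ i → restrict X g i ≡ restrict X h i
restrict-cong X g≗h i = cong (if does (i ∈? X) then_else 0ℚ) (g≗h i)

∑-restrict-⊥ : (g : Fin n → ℚ) → sum (restrict ⊥ g) ≡ 0ℚ
∑-restrict-⊥ {n} g = trans (sum-cong-≗ {n} (λ i → restrict-∉ ⊥ g {i} ∉⊥)) (sum-replicate-zero n)

∑-restrict-⁅⁆ : (x : Fin n) (g : Fin n → ℚ) → sum (restrict ⁅ x ⁆ g) ≡ g x
∑-restrict-⁅⁆ zero g = trans (cong (_+_ (g zero)) (∑-restrict-⊥ (g ∘ suc))) (+-identityʳ (g zero))
∑-restrict-⁅⁆ (suc x) g = trans (+-identityˡ _) (∑-restrict-⁅⁆ x (g ∘ suc))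

sumOver-restrict : (X : Subset n) (g : Fin n → ℚ) → sumOver X g ≡ sum (restrict X g)
sumOver-restrict {n} X g = along (λ i → i)
  where
  along : ∀ {m} (h : Fin m → Fin n) → foldr (λ x acc → g x + acc) 0ℚ (inOrder (tabulate h) X) ≡ sum (restrict X g ∘ h)
  along {zero} h = refl
  along {suc m} h with does (h zero ∈? X)
  ... | true = cong (_+_ (g (h zero))) (along (h ∘ suc))
  ... | false = trans (along (h ∘ suc)) (sym (+-identityˡ _))

∑-restrict : ∀ {m} (X : Subset n) (h : Fin n → Fin m → ℚ) (e : Fin n) →
  sum (λ i → restrict X (λ e → h e i) e) ≡ restrict X (λ e → sum (h e)) e
∑-restrict {m = m} X h e with e ∈? X
... | yes _ = refl
... | no _ = sum-replicate-zero m

module _ (X : Subset n) where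

  restrict-mono : {g h : Fin n → ℚ} → (∀ {e} → e ∈ X → g e ≤ h e) → ∀ i → restrict X g i ≤ restrict X h i
  restrict-mono g≤h i with i ∈? X
  ... | yes i∈X = g≤h i∈X
  ... | no _ = ≤-refl

  restrict-nonneg : {g : Fin n → ℚ} → (∀ {e} → e ∈ X → 0ℚ ≤ g e) → ∀ i → 0ℚ ≤ restrict X g i
  restrict-nonneg 0≤g i with i ∈? X
  ... | yes i∈X = 0≤g i∈X
  ... | no _ = ≤-refl

  restrict-nonpos : {g : Fin n → ℚ} → (∀ {e} → e ∈ X → g e ≤ 0ℚ) → ∀ i → restrict X g i ≤ 0ℚ
  restrict-nonpos g≤0 i with i ∈? X
  ... | yes i∈X = g≤0 i∈X
  ... | no _ = ≤-refl

  sumOver-mono : {g h : Fin n → ℚ} → (∀ {e} → e ∈ X → g e ≤ h e) → sumOver X g ≤ sumOver X h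
  sumOver-mono {g} {h} g≤h =
    subst₂ _≤_ (sym (sumOver-restrict X g)) (sym (sumOver-restrict X h)) (∑-mono-≤ (restrict-mono g≤h))

  sumOver-nonneg : {g : Fin n → ℚ} → (∀ {e} → e ∈ X → 0ℚ ≤ g e) → 0ℚ ≤ sumOver X g
  sumOver-nonneg {g} 0≤g = subst (0ℚ ≤_) (sym (sumOver-restrict X g)) (∑-nonneg (restrict-nonneg 0≤g))

  sumOver-nonpos : {g : Fin n → ℚ} → (∀ {e} → e ∈ X → g e ≤ 0ℚ) → sumOver X g ≤ 0ℚ
  sumOver-nonpos {g} g≤0 = subst (_≤ 0ℚ) (sym (sumOver-restrict X g)) (∑-nonpos (restrict-nonpos g≤0))

  term≤sumOver : {g : Fin n → ℚ} → (∀ {e} → e ∈ X → 0ℚ ≤ g e) → ∀ {e} → e ∈ X → g e ≤ sumOver X g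
  term≤sumOver {g} 0≤g {e} e∈X = begin
    g e                ≡⟨ restrict-∈ X g e∈X ⟨
    restrict X g e     ≤⟨ term≤∑ (restrict-nonneg 0≤g) e ⟩
    sum (restrict X g) ≡⟨ sumOver-restrict X g ⟨
    sumOver X g        ∎
    where open ≤-Reasoning

  sumOver-distrib-− : (g h : Fin n → ℚ) → sumOver X (λ e → g e - h e) ≡ sumOver X g - sumOver X h
  sumOver-distrib-− g h = begin
    sumOver X (λ e → g e - h e)                ≡⟨ sumOver-restrict X _ ⟩
    sum (restrict X (λ e → g e - h e))         ≡⟨ sum-cong-≗ {n} pointwise ⟩
    sum (λ i → restrict X g i - restrict X h i) ≡⟨ ∑-distrib-− (restrict X g) (restrict X h) ⟩
    sum (restrict X g) - sum (restrict X h)    ≡⟨ cong₂ _-_ (sumOver-restrict X g) (sumOver-restrict X h) ⟨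
    sumOver X g - sumOver X h                  ∎
    where
    open ≡-Reasoning
    pointwise : ∀ i → restrict X (λ e → g e - h e) i ≡ restrict X g i - restrict X h i
    pointwise i with i ∈? X
    ... | yes _ = refl
    ... | no _ = refl

  *-distribˡ-sumOver : (c : ℚ) (g : Fin n → ℚ) → c * sumOver X g ≡ sumOver X (λ e → c * g e)
  *-distribˡ-sumOver c g = begin
    c * sumOver X g                  ≡⟨ cong (c *_) (sumOver-restrict X g) ⟩
    c * sum (restrict X g)           ≡⟨ *-distribˡ-sum c (restrict X g) ⟩
    sum (λ i → c * restrict X g i)   ≡⟨ sum-cong-≗ {n} pointwise ⟩
    sum (restrict X (λ e → c * g e)) ≡⟨ sumOver-restrict X _ ⟨
    sumOver X (λ e → c * g e)        ∎
    where
    open ≡-Reasoning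
    pointwise : ∀ i → c * restrict X g i ≡ restrict X (λ e → c * g e) i
    pointwise i with i ∈? X
    ... | yes _ = refl
    ... | no _ = *-zeroʳ c

0≤p∧0≤q⇒0≤p*q : ∀ {p q} → 0ℚ ≤ p → 0ℚ ≤ q → 0ℚ ≤ p * q
0≤p∧0≤q⇒0≤p*q {p} {q} 0≤p 0≤q = nonNegative⁻¹ _ {{nonNeg*nonNeg⇒nonNeg p {{nonNegative 0≤p}} q {{nonNegative 0≤q}}}}

p≡q+[p-q] : ∀ p q → p ≡ q + (p - q)
p≡q+[p-q] = solve 2 (λ p q → p := q :+ (p :- q)) refl
  where open +-*-Solver

0≤p*p : ∀ p → 0ℚ ≤ p * p
0≤p*p p with ≤-total 0ℚ p
... | inj₁ 0≤p = 0≤p∧0≤q⇒0≤p*q 0≤p 0≤p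
... | inj₂ p≤0 = nonNegative⁻¹ _ {{nonPos*nonPos⇒nonPos p {{nonPositive p≤0}} p {{nonPositive p≤0}}}}

p*p≤0⇒p≤0 : ∀ {p} → p * p ≤ 0ℚ → p ≤ 0ℚ
p*p≤0⇒p≤0 {p} p*p≤0 = ≮⇒≥ λ 0<p →
  <-irrefl refl (<-≤-trans (positive⁻¹ _ {{pos*pos⇒pos p {{positive 0<p}} p {{positive 0<p}}}}) p*p≤0)

p≤q⇒0≤q-p : ∀ {p q} → p ≤ q → 0ℚ ≤ q - p
p≤q⇒0≤q-p {p} {q} p≤q = subst (_≤ q - p) (+-inverseʳ p) (+-monoˡ-≤ (- p) p≤q)

0≤p*q∧0<q⇒0≤p : ∀ {p q} → 0ℚ < q → 0ℚ ≤ p * q → 0ℚ ≤ p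
0≤p*q∧0<q⇒0≤p {p} {q} 0<q 0≤p*q = ≮⇒≥ λ p<0 →
  <-irrefl refl (≤-<-trans 0≤p*q (<-≤-trans (*-monoˡ-<-pos q {{positive 0<q}} p<0) (≤-reflexive (*-zeroˡ q))))

0≤z/1 : ∀ {z} → 0ℤ ≤ᶻ z → 0ℚ ≤ z / 1
0≤z/1 {+ m} _ = nonNegative⁻¹ _ {{normalize-nonNeg m 1}}

0≤floor : ∀ {p} → 0ℚ ≤ p → 0ℤ ≤ᶻ floor p
0≤floor {p@record{}} 0≤p = 0≤n⇒0≤n/d (↥ p) (↧ p) (ℤ.nonNegative⁻¹ (↥ p) {{nonNegative 0≤p}}) (ℤ.+≤+ ℕ.z≤n)

0≤quant : ∀ {α d} → 0ℚ ≤ α → 0ℚ ≤ d → 0ℚ ≤ quant α d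
0≤quant {α} {d} 0≤α 0≤d with α ≟ 0ℚ
... | yes _ = ≤-refl
... | no α≢0 = 0≤p∧0≤q⇒0≤p*q (0≤z/1 (0≤floor 0≤d÷α)) 0≤α
  where
  instance
    α-nonZero : NonZero α
    α-nonZero = ≢-nonZero α≢0
    α-pos : Positive α
    α-pos = nonNeg∧nonZero⇒pos α {{nonNegative 0≤α}}
  0≤d÷α : 0ℚ ≤ d ÷ α
  0≤d÷α = 0≤p∧0≤q⇒0≤p*q 0≤d (<⇒≤ (positive⁻¹ _ {{1/pos⇒pos α}}))

0≤wt : {f : Subset n → ℚ} {α : ℚ} → Monotone f → 0ℚ ≤ α → ∀ base L y → 0ℚ ≤ wt f α base L y
0≤wt f-mono 0≤α base [] y = ≤-refl
0≤wt f-mono 0≤α base (z ∷ L) y with z Fin.≟ y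
... | yes _ = 0≤quant 0≤α (p≤q⇒0≤q-p (f-mono base (base ∪ ⁅ z ⁆) (p⊆p∪q ⁅ z ⁆)))
... | no _ = 0≤wt f-mono 0≤α (base ∪ ⁅ z ⁆) L y

0<n/1 : Fin n → 0ℚ < + n / 1
0<n/1 {suc m} _ = positive⁻¹ _ {{normalize-pos (suc m) 1}}

0≤α : ∀ (k : ℕ) {ε δ α c} → Fin n → 0ℚ < ε → 0ℚ ≤ c
  → δ * ((ε + ε) + (+ (k ℕ.+ 3) / 1)) ≡ ε + ε → α * (+ n / 1) ≡ c * δ → 0ℚ ≤ α
0≤α k {ε} {δ} e 0<ε 0≤c δ-def α-def =
  0≤p*q∧0<q⇒0≤p (0<n/1 e) (subst (0ℚ ≤_) (sym α-def) (0≤p∧0≤q⇒0≤p*q 0≤c 0≤δ))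
  where
  0<2ε : 0ℚ < ε + ε
  0<2ε = +-mono-< 0<ε 0<ε
  0≤δ : 0ℚ ≤ δ
  0≤δ = 0≤p*q∧0<q⇒0≤p (+-mono-<-≤ 0<2ε (0≤z/1 {+ (k ℕ.+ 3)} (ℤ.+≤+ ℕ.z≤n)))
                      (subst (0ℚ ≤_) (sym δ-def) (<⇒≤ 0<2ε))

x∈p─q⇒x∉q : ∀ (p q : Subset n) {x} → x ∈ p ─ q → x ∉ q
x∈p─q⇒x∉q (_ ∷ p) (outside ∷ q) (there x∈p─q) (there x∈q) = x∈p─q⇒x∉q p q x∈p─q x∈q
x∈p─q⇒x∉q (_ ∷ p) (inside ∷ q) (there x∈p─q) (there x∈q) = x∈p─q⇒x∉q p q x∈p─q x∈q

∣p∪q∣≤∣p∣+∣q∣ : ∀ (p q : Subset n) → ∣ p ∪ q ∣ ℕ.≤ ∣ p ∣ ℕ.+ ∣ q ∣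
∣p∪q∣≤∣p∣+∣q∣ [] [] = ℕ.z≤n
∣p∪q∣≤∣p∣+∣q∣ (outside ∷ p) (outside ∷ q) = ∣p∪q∣≤∣p∣+∣q∣ p q
∣p∪q∣≤∣p∣+∣q∣ (outside ∷ p) (inside ∷ q) =
  subst (∣ p ∪ q ∣ ℕ.<_) (sym (ℕ.+-suc ∣ p ∣ ∣ q ∣)) (ℕ.s≤s (∣p∪q∣≤∣p∣+∣q∣ p q))
∣p∪q∣≤∣p∣+∣q∣ (inside ∷ p) (outside ∷ q) = ℕ.s≤s (∣p∪q∣≤∣p∣+∣q∣ p q)
∣p∪q∣≤∣p∣+∣q∣ (inside ∷ p) (inside ∷ q) =
  ℕ.s≤s (ℕ.≤-trans (∣p∪q∣≤∣p∣+∣q∣ p q) (ℕ.+-monoʳ-≤ ∣ p ∣ (ℕ.n≤1+n ∣ q ∣)))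

unionOver : ∀ {m} → Subset n → (Fin n → Subset m) → Subset m
unionOver [] Z = ⊥
unionOver (outside ∷ P) Z = unionOver P (Z ∘ suc)
unionOver (inside ∷ P) Z = Z zero ∪ unionOver P (Z ∘ suc)

∈-unionOver : ∀ {m} (P : Subset n) (Z : Fin n → Subset m) {e y} → e ∈ P → y ∈ Z e → y ∈ unionOver P Z
∈-unionOver (inside ∷ P) Z here y∈Z = x∈p∪q⁺ (inj₁ y∈Z)
∈-unionOver (outside ∷ P) Z (there e∈P) y∈Z = ∈-unionOver P (Z ∘ suc) e∈P y∈Z
∈-unionOver (inside ∷ P) Z (there e∈P) y∈Z = x∈p∪q⁺ (inj₂ (∈-unionOver P (Z ∘ suc) e∈P y∈Z))

∣unionOver∣≤ : ∀ {m} c (P : Subset n) (Z : Fin n → Subset m) →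
  (∀ {e} → e ∈ P → ∣ Z e ∣ ℕ.≤ c) → ∣ unionOver P Z ∣ ℕ.≤ c ℕ.* ∣ P ∣
∣unionOver∣≤ {m = m} c [] Z ∣Z∣≤c = ℕ.≤-reflexive (trans (∣⊥∣≡0 m) (sym (ℕ.*-zeroʳ c)))
∣unionOver∣≤ c (outside ∷ P) Z ∣Z∣≤c = ∣unionOver∣≤ c P (Z ∘ suc) (∣Z∣≤c ∘ there)
∣unionOver∣≤ c (inside ∷ P) Z ∣Z∣≤c = begin
  ∣ Z zero ∪ unionOver P (Z ∘ suc) ∣       ≤⟨ ∣p∪q∣≤∣p∣+∣q∣ (Z zero) _ ⟩
  ∣ Z zero ∣ ℕ.+ ∣ unionOver P (Z ∘ suc) ∣ ≤⟨ ℕ.+-mono-≤ (∣Z∣≤c here) (∣unionOver∣≤ c P (Z ∘ suc) (∣Z∣≤c ∘ there)) ⟩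
  c ℕ.+ c ℕ.* ∣ P ∣                        ≡⟨ ℕ.*-suc c ∣ P ∣ ⟨
  c ℕ.* suc ∣ P ∣                          ∎
  where open ℕ.≤-Reasoning

select : {Q : Fin n → Set} → (∀ i → Dec (Q i)) → Subset n
select Q? = Vec.tabulate (λ i → does (Q? i))

∈-select⁺ : {Q : Fin n → Set} (Q? : ∀ i → Dec (Q i)) {i : Fin n} → Q i → i ∈ select Q?
∈-select⁺ Q? {i} q with Q? i in eq
... | yes _ = lookup⇒[]= i _ (trans (lookup∘tabulate _ i) (cong does eq))
... | no ¬q = contradiction q ¬q

∈-select⁻ : {Q : Fin n → Set} (Q? : ∀ i → Dec (Q i)) {i : Fin n} → i ∈ select Q? → Q i
∈-select⁻ Q? {i} i∈Q with Q? i in eq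
... | yes q = q
... | no _ with () ← trans (sym (cong does eq)) (trans (sym (lookup∘tabulate _ i)) ([]=⇒lookup i∈Q))

module _ {k : ℕ} {I : Subset n → Set} {O S : Subset n} {Y : Fin n → Subset n}
  (nbhd : NeighborhoodCollection k I O S Y) where

  private
    K1 : ∀ e → e ∈ O ─ S → (Y e ⊆ S ─ O) × (∣ Y e ∣ ℕ.≤ k)
    K1 = proj₁ (proj₁ nbhd)
    K2 : ∀ y → y ∈ S ─ O → (E : Subset n) → (∀ e → (e ∈ E) ⇔ (e ∈ O ─ S × y ∈ Y e)) → ∣ E ∣ ℕ.≤ k
    K2 = proj₁ (proj₂ (proj₁ nbhd))
    K3 : ∀ (C U : Subset n) → C ⊆ O ─ S → (∀ y → (y ∈ U) ⇔ (∃[ e ] (e ∈ C × y ∈ Y e))) → I ((S ─ U) ∪ C)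
    K3 = proj₂ (proj₂ (proj₁ nbhd))
    Y-⁅⁆ : ∀ e → e ∈ O → e ∈ S → Y e ≡ ⁅ e ⁆
    Y-⁅⁆ = proj₂ nbhd

  Y⊆S : ∀ {e} → e ∈ O → Y e ⊆ S
  Y⊆S {e} e∈O {y} y∈Y with e ∈? S
  ... | yes e∈S = subst (_∈ S) (sym (x∈⁅y⁆⇒x≡y e (subst (y ∈_) (Y-⁅⁆ e e∈O e∈S) y∈Y))) e∈S
  ... | no e∉S = p─q⊆p S O (proj₁ (K1 e (x∈p∧x∉q⇒x∈p─q e∈O e∉S)) y∈Y)

  ∣Y∣≤k : 1 ℕ.≤ k → ∀ {e} → e ∈ O → ∣ Y e ∣ ℕ.≤ k
  ∣Y∣≤k 1≤k {e} e∈O with e ∈? S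
  ... | yes e∈S = subst (ℕ._≤ k) (sym (trans (cong ∣_∣ (Y-⁅⁆ e e∈O e∈S)) (∣⁅x⁆∣≡1 e))) 1≤k
  ... | no e∉S = proj₂ (K1 e (x∈p∧x∉q⇒x∈p─q e∈O e∉S))

  e∈Y[e] : ∀ {e} → e ∈ O → e ∈ S → e ∈ Y e
  e∈Y[e] {e} e∈O e∈S = subst (e ∈_) (sym (Y-⁅⁆ e e∈O e∈S)) (x∈⁅x⁆ e)

  module _ {x : Fin n} {P N : Subset n} (x∈S : x ∈ S)
    (P⊆ : ∀ {e} → e ∈ P → e ∈ O × x ∈ Y e)
    (N-def : ∀ y → (y ∈ N) ⇔ (∃[ e ] (e ∈ P × y ∈ Y e))) where

    N⊆S : N ⊆ S
    N⊆S {y} y∈N with proj₁ (N-def y) y∈N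
    ... | e , e∈P , y∈Y = Y⊆S (proj₁ (P⊆ e∈P)) y∈Y

    P∩[S─N]≡∅ : ∀ {e} → e ∈ P → e ∉ S ─ N
    P∩[S─N]≡∅ {e} e∈P e∈S─N =
      x∈p─q⇒x∉q S N e∈S─N (proj₂ (N-def e) (e , e∈P , e∈Y[e] (proj₁ (P⊆ e∈P)) (p─q⊆p S N e∈S─N)))

    e∈P∩S⇒e≡x : ∀ {e} → e ∈ P → e ∈ S → e ≡ x
    e∈P∩S⇒e≡x {e} e∈P e∈S =
      sym (x∈⁅y⁆⇒x≡y e (subst (x ∈_) (Y-⁅⁆ e (proj₁ (P⊆ e∈P)) e∈S) (proj₂ (P⊆ e∈P))))

    x∈O⇒P⊆⁅x⁆ : x ∈ O → P ⊆ ⁅ x ⁆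
    x∈O⇒P⊆⁅x⁆ x∈O {e} e∈P with e ∈? S
    ... | yes e∈S = subst (_∈ ⁅ x ⁆) (sym (e∈P∩S⇒e≡x e∈P e∈S)) (x∈⁅x⁆ x)
    ... | no e∉S = contradiction x∈O
      (x∈p─q⇒x∉q S O (proj₁ (K1 e (x∈p∧x∉q⇒x∈p─q (proj₁ (P⊆ e∈P)) e∉S)) (proj₂ (P⊆ e∈P))))

    x∉O⇒P⊆O─S : x ∉ O → P ⊆ O ─ S
    x∉O⇒P⊆O─S x∉O {e} e∈P with e ∈? S
    ... | yes e∈S = contradiction (subst (_∈ O) (e∈P∩S⇒e≡x e∈P e∈S) (proj₁ (P⊆ e∈P))) x∉O
    ... | no e∉S = x∈p∧x∉q⇒x∈p─q (proj₁ (P⊆ e∈P)) e∉S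

    ∣P∣≤k : 1 ℕ.≤ k → ∣ P ∣ ℕ.≤ k
    ∣P∣≤k 1≤k with x ∈? O
    ... | yes x∈O = ℕ.≤-trans (p⊆q⇒∣p∣≤∣q∣ (x∈O⇒P⊆⁅x⁆ x∈O)) (subst (ℕ._≤ k) (sym (∣⁅x⁆∣≡1 x)) 1≤k)
    ... | no x∉O = ℕ.≤-trans (p⊆q⇒∣p∣≤∣q∣ P⊆E)
                     (K2 x (x∈p∧x∉q⇒x∈p─q x∈S x∉O) E (λ e → ∈-select⁻ E? , ∈-select⁺ E?))
      where
      E? : ∀ e → Dec (e ∈ O ─ S × x ∈ Y e)
      E? e = (e ∈? O ─ S) ×-dec (x ∈? Y e)
      E : Subset n
      E = select E?
      P⊆E : P ⊆ E
      P⊆E e∈P = ∈-select⁺ E? (x∉O⇒P⊆O─S x∉O e∈P , proj₂ (P⊆ e∈P))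

    N⊆⁅x⁆∪⋃[Y─x] : N ⊆ ⁅ x ⁆ ∪ unionOver P (λ e → Y e ─ ⁅ x ⁆)
    N⊆⁅x⁆∪⋃[Y─x] {y} y∈N with proj₁ (N-def y) y∈N
    ... | e , e∈P , y∈Y with y Fin.≟ x
    ... | yes refl = x∈p∪q⁺ (inj₁ (x∈⁅x⁆ x))
    ... | no y≢x = x∈p∪q⁺ (inj₂ (∈-unionOver P (λ e → Y e ─ ⁅ x ⁆) e∈P (x∈p∧x≢y⇒x∈p-y y∈Y y≢x)))

    ∣N∣≤k*k∸k+1 : 1 ℕ.≤ k → ∣ N ∣ ℕ.≤ k ℕ.* k ℕ.∸ k ℕ.+ 1
    ∣N∣≤k*k∸k+1 1≤k = begin
      ∣ N ∣                                             ≤⟨ p⊆q⇒∣p∣≤∣q∣ N⊆⁅x⁆∪⋃[Y─x] ⟩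
      ∣ ⁅ x ⁆ ∪ unionOver P (λ e → Y e ─ ⁅ x ⁆) ∣       ≤⟨ ∣p∪q∣≤∣p∣+∣q∣ ⁅ x ⁆ _ ⟩
      ∣ ⁅ x ⁆ ∣ ℕ.+ ∣ unionOver P (λ e → Y e ─ ⁅ x ⁆) ∣ ≤⟨ ℕ.+-mono-≤ (ℕ.≤-reflexive (∣⁅x⁆∣≡1 x)) ∣⋃∣≤ ⟩
      1 ℕ.+ (k ℕ.∸ 1) ℕ.* k                             ≡⟨ ℕ.+-comm 1 _ ⟩
      (k ℕ.∸ 1) ℕ.* k ℕ.+ 1                             ≡⟨ cong (ℕ._+ 1) (ℕ.*-distribʳ-∸ k k 1) ⟩
      k ℕ.* k ℕ.∸ 1 ℕ.* k ℕ.+ 1                         ≡⟨ cong (λ m → k ℕ.* k ℕ.∸ m ℕ.+ 1) (ℕ.*-identityˡ k) ⟩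
      k ℕ.* k ℕ.∸ k ℕ.+ 1                               ∎
      where
      open ℕ.≤-Reasoning
      ∣Y─x∣≤k∸1 : ∀ {e} → e ∈ P → ∣ Y e ─ ⁅ x ⁆ ∣ ℕ.≤ k ℕ.∸ 1
      ∣Y─x∣≤k∸1 e∈P = ℕ.suc[m]≤n⇒m≤pred[n]
        (ℕ.≤-trans (x∈p⇒∣p-x∣<∣p∣ (proj₂ (P⊆ e∈P))) (∣Y∣≤k 1≤k (proj₁ (P⊆ e∈P))))
      ∣⋃∣≤ : ∣ unionOver P (λ e → Y e ─ ⁅ x ⁆) ∣ ℕ.≤ (k ℕ.∸ 1) ℕ.* k
      ∣⋃∣≤ = ℕ.≤-trans (∣unionOver∣≤ (k ℕ.∸ 1) P _ ∣Y─x∣≤k∸1) (ℕ.*-monoʳ-≤ (k ℕ.∸ 1) (∣P∣≤k 1≤k))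

    independent : IndependenceSystem I → I ((S ─ N) ∪ P)
    independent (_ , downward-closed) with x ∈? O
    ... | no x∉O = K3 P N (x∉O⇒P⊆O─S x∉O) N-def
    ... | yes x∈O = downward-closed _ _ ⊆[S─⊥]∪⊥ I[[S─⊥]∪⊥]
      where
      -- No hypothesis states I S; it is the case C = ∅ of (K3).
      I[[S─⊥]∪⊥] : I ((S ─ ⊥) ∪ ⊥)
      I[[S─⊥]∪⊥] = K3 ⊥ ⊥ (λ e∈⊥ → contradiction e∈⊥ ∉⊥)
        (λ y → (λ y∈⊥ → contradiction y∈⊥ ∉⊥) , λ { (_ , e∈⊥ , _) → contradiction e∈⊥ ∉⊥ })
      ⊆[S─⊥]∪⊥ : (S ─ N) ∪ P ⊆ (S ─ ⊥) ∪ ⊥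
      ⊆[S─⊥]∪⊥ {y} y∈ = x∈p∪q⁺ (inj₁ (x∈p∧x∉q⇒x∈p─q y∈S ∉⊥))
        where
        y∈S : y ∈ S
        y∈S with x∈p∪q⁻ (S ─ N) P y∈
        ... | inj₁ y∈S─N = p─q⊆p S N y∈S─N
        ... | inj₂ y∈P = subst (_∈ S) (sym (x∈⁅y⁆⇒x≡y x (x∈O⇒P⊆⁅x⁆ x∈O y∈P))) x∈S

    isKReplacement : 1 ℕ.≤ k → IndependenceSystem I → IsKReplacement k I S P N
    isKReplacement 1≤k indep = N⊆S , (λ _ → P∩[S─N]≡∅) , ∣P∣≤k 1≤k , ∣N∣≤k*k∸k+1 1≤k , independent indep

exchange-term : ∀ a W c → W * ((+ 2 / 1) * a - c) ≤ a * a - W * (c - W)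
exchange-term a W c = begin
  W * ((+ 2 / 1) * a - c)                           ≡⟨ +-identityˡ _ ⟨
  0ℚ + W * ((+ 2 / 1) * a - c)                      ≤⟨ +-monoˡ-≤ _ (0≤p*p (a - W)) ⟩
  (a - W) * (a - W) + W * ((+ 2 / 1) * a - c)       ≡⟨ solve 3 (λ a W c →
     (a :- W) :* (a :- W) :+ W :* (con (+ 2 / 1) :* a :- c) := a :* a :- W :* (c :- W)) refl a W c ⟩
  a * a - W * (c - W)                               ∎
  where
  open ≤-Reasoning
  open +-*-Solver

module _ (w : Fin n → ℚ) (x : Fin n) (Y : Fin n → Subset n) (P N : Subset n)
  (0≤w : ∀ z → 0ℚ ≤ w z)
  (x∈Y : ∀ {e} → e ∈ P → x ∈ Y e)
  (w≤wx : ∀ {e z} → e ∈ P → z ∈ Y e → w z ≤ w x)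
  (N⊆⋃Y : ∀ {z} → z ∈ N → ∃[ e ] (e ∈ P × z ∈ Y e))
  where

  sumOver-sq-N≤ : sumOver N (λ z → w z * w z) ≤ w x * sumOver N w
  sumOver-sq-N≤ = begin
    sumOver N (λ z → w z * w z) ≤⟨ sumOver-mono N wz*wz≤wx*wz ⟩
    sumOver N (λ z → w x * w z) ≡⟨ *-distribˡ-sumOver N (w x) w ⟨
    w x * sumOver N w           ∎
    where
    open ≤-Reasoning
    wz*wz≤wx*wz : ∀ {z} → z ∈ N → w z * w z ≤ w x * w z
    wz*wz≤wx*wz {z} z∈N with N⊆⋃Y z∈N
    ... | e , e∈P , z∈Ye = *-monoʳ-≤-nonNeg (w z) {{nonNegative (0≤w z)}} (w≤wx e∈P z∈Ye)

  sumOver-N≤ : sumOver N w ≤ w x + sumOver P (λ e → sumOver (Y e) w - w x)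
  sumOver-N≤ = begin
    sumOver N w                                                 ≡⟨ sumOver-restrict N w ⟩
    sum (restrict N w)                                          ≤⟨ ∑-mono-≤ (λ i → covered i (i ∈? N)) ⟩
    sum (λ i → restrict ⁅ x ⁆ w i + sum (t i))                  ≡⟨ ∑-distrib-+ (restrict ⁅ x ⁆ w) _ ⟩
    sum (restrict ⁅ x ⁆ w) + sum (λ i → sum (t i))              ≡⟨ cong₂ _+_ (∑-restrict-⁅⁆ x w) (∑-comm t) ⟩
    w x + sum (λ e → sum (λ i → t i e))                         ≡⟨ cong (_+_ (w x)) (sum-cong-≗ {n} (∑-restrict P g)) ⟩
    w x + sum (restrict P (λ e → sum (g e)))                    ≡⟨ cong (_+_ (w x)) (sum-cong-≗ {n} (restrict-cong P ∑g≡)) ⟩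
    w x + sum (restrict P (λ e → sumOver (Y e) w - w x))        ≡⟨ cong (_+_ (w x)) (sumOver-restrict P _) ⟨
    w x + sumOver P (λ e → sumOver (Y e) w - w x)               ∎
    where
    open ≤-Reasoning
    g : Fin n → Fin n → ℚ
    g e i = restrict (Y e) w i - restrict ⁅ x ⁆ w i
    t : Fin n → Fin n → ℚ
    t i e = restrict P (λ e → g e i) e
    ∑g≡ : ∀ e → sum (g e) ≡ sumOver (Y e) w - w x
    ∑g≡ e = trans (∑-distrib-− (restrict (Y e) w) (restrict ⁅ x ⁆ w))
                  (cong₂ _-_ (sym (sumOver-restrict (Y e) w)) (∑-restrict-⁅⁆ x w))
    0≤g : ∀ {e} → e ∈ P → ∀ i → 0ℚ ≤ g e i
    0≤g {e} e∈P i with i Fin.≟ x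
    ... | yes refl = begin
      0ℚ                                      ≡⟨ +-inverseʳ (w x) ⟨
      w x - w x                               ≡⟨ cong₂ _-_ (restrict-∈ (Y e) w (x∈Y e∈P)) (restrict-∈ ⁅ x ⁆ w (x∈⁅x⁆ x)) ⟨
      restrict (Y e) w x - restrict ⁅ x ⁆ w x ∎
    ... | no i≢x = begin
      0ℚ                                      ≤⟨ restrict-nonneg (Y e) (λ {z} _ → 0≤w z) i ⟩
      restrict (Y e) w i                      ≡⟨ +-identityʳ (restrict (Y e) w i) ⟨
      restrict (Y e) w i - 0ℚ                 ≡⟨ cong (_-_ (restrict (Y e) w i)) (restrict-∉ ⁅ x ⁆ w (x≢y⇒x∉⁅y⁆ i≢x)) ⟨
      restrict (Y e) w i - restrict ⁅ x ⁆ w i ∎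
    0≤t : ∀ i e → 0ℚ ≤ t i e
    0≤t i = restrict-nonneg P (λ e∈P → 0≤g e∈P i)
    covered : ∀ i → Dec (i ∈ N) → restrict N w i ≤ restrict ⁅ x ⁆ w i + sum (t i)
    covered i (no i∉N) = begin
      restrict N w i                       ≡⟨ restrict-∉ N w i∉N ⟩
      0ℚ                                   ≤⟨ +-mono-≤ (restrict-nonneg ⁅ x ⁆ (λ {z} _ → 0≤w z) i)
                                                       (∑-nonneg (0≤t i)) ⟩
      restrict ⁅ x ⁆ w i + sum (t i)       ∎
    covered i (yes i∈N) with N⊆⋃Y i∈N
    ... | e , e∈P , i∈Ye = begin
      restrict N w i                       ≡⟨ restrict-∈ N w i∈N ⟩
      w i                                  ≡⟨ restrict-∈ (Y e) w i∈Ye ⟨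
      restrict (Y e) w i                   ≡⟨ p≡q+[p-q] (restrict (Y e) w i) (restrict ⁅ x ⁆ w i) ⟩
      restrict ⁅ x ⁆ w i + g e i           ≡⟨ cong (_+_ (restrict ⁅ x ⁆ w i)) (restrict-∈ P (λ e → g e i) e∈P) ⟨
      restrict ⁅ x ⁆ w i + t i e           ≤⟨ +-monoʳ-≤ (restrict ⁅ x ⁆ w i) (term≤∑ (0≤t i) e) ⟩
      restrict ⁅ x ⁆ w i + sum (t i)       ∎

  module _ (a : Fin n → ℚ) (P-sq≤N-sq : sumOver P (λ e → a e * a e) ≤ sumOver N (λ z → w z * w z)) where

    exchange-bound-pos : 0ℚ < w x → sumOver P (λ e → (+ 2 / 1) * a e - sumOver (Y e) w) ≤ w x
    exchange-bound-pos 0<wx = *-cancelˡ-≤-pos W {{positive 0<wx}} (begin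
      W * sumOver P (λ e → (+ 2 / 1) * a e - c e)   ≡⟨ *-distribˡ-sumOver P W _ ⟩
      sumOver P (λ e → W * ((+ 2 / 1) * a e - c e)) ≤⟨ sumOver-mono P (λ {e} _ → exchange-term (a e) W (c e)) ⟩
      sumOver P (λ e → a e * a e - W * d e)         ≡⟨ sumOver-distrib-− P (λ e → a e * a e) (λ e → W * d e) ⟩
      A - sumOver P (λ e → W * d e)                 ≡⟨ cong (_-_ A) (*-distribˡ-sumOver P W d) ⟨
      A - W * D                                     ≤⟨ +-monoˡ-≤ _ (≤-trans P-sq≤N-sq sumOver-sq-N≤) ⟩
      W * sumOver N w - W * D                       ≤⟨ +-monoˡ-≤ _ (*-monoˡ-≤-nonNeg W {{nonNegative (0≤w x)}} sumOver-N≤) ⟩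
      W * (W + D) - W * D                           ≡⟨ solve 2 (λ W D → W :* (W :+ D) :- W :* D := W :* W) refl W D ⟩
      W * W                                         ∎)
      where
      open ≤-Reasoning
      open +-*-Solver
      W : ℚ
      W = w x
      c d : Fin n → ℚ
      c e = sumOver (Y e) w
      d e = c e - W
      A D : ℚ
      A = sumOver P (λ e → a e * a e)
      D = sumOver P d

    exchange-bound-nonpos : w x ≤ 0ℚ → sumOver P (λ e → (+ 2 / 1) * a e - sumOver (Y e) w) ≤ w x
    exchange-bound-nonpos wx≤0 = ≤-trans (sumOver-nonpos P term≤0) (0≤w x)
      where
      P-sq≤0 : sumOver P (λ e → a e * a e) ≤ 0ℚ
      P-sq≤0 = begin
        sumOver P (λ e → a e * a e) ≤⟨ ≤-trans P-sq≤N-sq sumOver-sq-N≤ ⟩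
        w x * sumOver N w           ≤⟨ *-monoʳ-≤-nonNeg (sumOver N w) {{nonNegative 0≤∑N}} wx≤0 ⟩
        0ℚ * sumOver N w            ≡⟨ *-zeroˡ (sumOver N w) ⟩
        0ℚ                          ∎
        where
        open ≤-Reasoning
        0≤∑N : 0ℚ ≤ sumOver N w
        0≤∑N = sumOver-nonneg N (λ {z} _ → 0≤w z)
      term≤0 : ∀ {e} → e ∈ P → (+ 2 / 1) * a e - sumOver (Y e) w ≤ 0ℚ
      term≤0 {e} e∈P = +-mono-≤ 2a≤0 (neg-antimono-≤ (sumOver-nonneg (Y e) (λ {z} _ → 0≤w z)))
        where
        a≤0 : a e ≤ 0ℚ
        a≤0 = p*p≤0⇒p≤0 (≤-trans (term≤sumOver P (λ {e′} _ → 0≤p*p (a e′)) e∈P) P-sq≤0)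
        2a≤0 : (+ 2 / 1) * a e ≤ 0ℚ
        2a≤0 = *-monoˡ-≤-nonNeg (+ 2 / 1) a≤0

    exchange-bound : sumOver P (λ e → (+ 2 / 1) * a e - sumOver (Y e) w) ≤ w x
    exchange-bound with 0ℚ <? w x
    ... | yes 0<wx = exchange-bound-pos 0<wx
    ... | no 0≮wx = exchange-bound-nonpos (≮⇒≥ 0≮wx)

lemma3 : ∀ {n : ℕ} (k : ℕ) → 1 ℕ.≤ k
    → (I : Subset n → Set) → KExchangeSystem k I
    → (f : Subset n → ℚ) → NonNegative f → Monotone f → Submodular f
    → (ε : ℚ) → 0ℚ < ε → ε < 1ℚ
    → (e* : Fin n) → (∀ e → f ⁅ e ⁆ ≤ f ⁅ e* ⁆)
    → (δ α : ℚ)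
    → δ * ((ε + ε) + (+ (k ℕ.+ 3) / 1)) ≡ ε + ε
    → α * (+ n / 1) ≡ f ⁅ e* ⁆ * δ
    → (ord₀ : List (Fin n)) → allFin n ↭ ord₀
    → (S : Subset n) (ord : List (Fin n)) → Returned k I f α (⁅ e* ⁆ , ord₀) (S , ord)
    → (O : Subset n) → I O → (∀ A → I A → f A ≤ f O)
    → (Y : Fin n → Subset n) → NeighborhoodCollection k I O S Y
    → (x : Fin n) → x ∈ S
    → (P N : Subset n)
    → (∀ e → (e ∈ P) ⇔ (e ∈ O × x ∈ Y e × (∀ z → z ∈ Y e → weight f α ord S z ≤ weight f α ord S x)))
    → (∀ y → (y ∈ N) ⇔ (∃[ e ] (e ∈ P × y ∈ Y e)))
    → sumOver P (λ e → ((+ 2 / 1) * replWeight f α ord S P N e) - sumOver (Y e) (weight f α ord S))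
        ≤ weight f α ord S x
lemma3 k 1≤k I (indep , _) f 0≤f f-mono _ ε 0<ε _ e* _ δ α δ-def α-def _ _ S ord (_ , locally-optimal)
       O _ _ Y nbhd x x∈S P N P-def N-def =
  exchange-bound w x Y P N 0≤w x∈Y w≤wx N⊆⋃Y (replWeight f α ord S P N) P-sq≤N-sq
  where
  w : Fin _ → ℚ
  w = weight f α ord S
  0≤w : ∀ z → 0ℚ ≤ w z
  0≤w = 0≤wt f-mono (0≤α k e* 0<ε (0≤f _) δ-def α-def) ⊥ (inOrder ord S)
  x∈Y : ∀ {e} → e ∈ P → x ∈ Y e
  x∈Y e∈P = proj₁ (proj₂ (proj₁ (P-def _) e∈P))
  w≤wx : ∀ {e z} → e ∈ P → z ∈ Y e → w z ≤ w x
  w≤wx e∈P = proj₂ (proj₂ (proj₁ (P-def _) e∈P)) _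
  N⊆⋃Y : ∀ {z} → z ∈ N → ∃[ e ] (e ∈ P × z ∈ Y e)
  N⊆⋃Y = proj₁ (N-def _)
  P⊆ : ∀ {e} → e ∈ P → e ∈ O × x ∈ Y e
  P⊆ e∈P = proj₁ (proj₁ (P-def _) e∈P) , x∈Y e∈P
  P-sq≤N-sq : sumOver P (λ e → replWeight f α ord S P N e * replWeight f α ord S P N e) ≤ sumOver N (λ z → w z * w z)
  P-sq≤N-sq = ≮⇒≥ (locally-optimal P N (isKReplacement nbhd x∈S P⊆ N-def 1≤k indep))
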